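{- For all equivalent reduced $n$-expressions $u,v$, $$\operatorname{dist}(u,v) \ge I_3(S(u),S(v)) + I_{2,2}(S(u),S(v)).$$ More precisely, every sequence of braid-relation applications transforming $u$ into $v$ contains at least $I_3(S(u),S(v))$ applications of relations of type I and at least $I_{2,2}(S(u),S(v))$ applications of relations of type II.
   Context: For $1\le i\le n-1$, $\sigma_i$ is the transposition exchanging $i$ and $i+1$. An $n$-expression is a word over $\{\sigma_1,\dots,\sigma_{n-1}\}$, representing the product of its letters read left to right; equivalent means same permutation; reduced means no shorter equivalent expression. Braid relations: type I: $\sigma_i\sigma_j\sigma_i=\sigma_j\sigma_i\sigma_j$ for $|i-j|=1$; type II: $\sigma_i\sigma_j=\sigma_j\sigma_i$ for $|i-j|\ge2$. $\operatorname{dist}(u,v)$ is the minimal number of braid-relation applications transforming $u$ into $v$. Names: for a word $w$ define a bijection $\tau_w$ of $\{1,\dots,n\}$ by $\tau_{\varepsilon}=\mathrm{id}$ and $\tau_{w\sigma_i}=\tau_w\circ(i\ i{+}1)$ ($\tau_w(x)$ is the starting position of the strand at position $x$ after $w$). If $u=w\sigma_i w''$, the name of this occurrence of $\sigma_i$ is the pair $\{\tau_w(i),\tau_w(i+1)\}$. $S(u)$ is the sequence of names of the successive letters of $u$. For equivalent reduced $u,v$, $S(u)$ and $S(v)$ enumerate the same set of pairs. $I_3(S,S')$ is the number of 3-element subsets $\{p,q,r\}\subseteq\{1,\dots,n\}$ such that the relative order in which the pairs among $\{p,q\},\{p,r\},\{q,r\}$ occur is not the same in $S$ and $S'$. $I_{2,2}(S,S')$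 is the number of unordered pairs $\{\{p,q\},\{p',q'\}\}$ of disjoint 2-element subsets of $\{1,\dots,n\}$ such that the order in which $\{p,q\}$ and $\{p',q'\}$ occur is not the same in $S$ and $S'$. -}

module Defs where

open import Data.Nat using (ℕ; zero; suc; _+_; _≤_; _<_; _≡ᵇ_; _<ᵇ_)
open import Data.Bool using (Bool; true; false; if_then_else_; _∧_; _∨_; not)
open import Data.List using (List; []; _∷_; _++_; length; map; concatMap; upTo; filter)
open import Data.List.Relation.Unary.All using (All)
open import Data.Maybe using (Maybe; just; nothing)
open import Data.Product using (_×_; _,_)
open import Data.Sum using (_⊎_)
open import Function using (_∘_; id)
open import Relation.Binary.PropositionalEquality using (_≡_)

-- Expressions.  A letter σ_i is represented by the natural number i.
-- Positions are 1,…,n.  An n-expression is a list of letters i with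
-- 1 ≤ i and i + 1 ≤ n.

Word : Set
Word = List ℕ

ValidLetter : ℕ → ℕ → Set
ValidLetter n i = (1 ≤ i) × (suc i ≤ n)

Valid : ℕ → Word → Set
Valid n w = All (ValidLetter n) w

swap : ℕ → ℕ → ℕ
swap i x = if x ≡ᵇ i then suc i else (if x ≡ᵇ suc i then i else x)

-- τ_w :  τ_ε = id,  τ_{wσ_i} = τ_w ∘ (i i+1).
-- Hence τ_{i₁…i_k} = s_{i₁} ∘ … ∘ s_{i_k}, i.e. τ_{σ_i w} = s_i ∘ τ_w.
tau : Word → ℕ → ℕ
tau []      = id
tau (i ∷ w) = swap i ∘ tau w

Equiv : Word → Word → Set
Equiv u v = ∀ x → tau u x ≡ tau v x

Reduced : ℕ → Word → Set
Reduced n u = ∀ w → Valid n w → Equiv w u → length u ≤ length w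

-- Braid relations, applied anywhere inside a word (either direction:
-- both directions are instances since i, j range freely).

Adjacent : ℕ → ℕ → Set
Adjacent i j = (i ≡ suc j) ⊎ (j ≡ suc i)

Distant : ℕ → ℕ → Set
Distant i j = (suc (suc i) ≤ j) ⊎ (suc (suc j) ≤ i)

data Step : Word → Word → Set where
  typeI  : ∀ (a b : Word) (i j : ℕ) → Adjacent i j →
           Step (a ++ i ∷ j ∷ i ∷ b) (a ++ j ∷ i ∷ j ∷ b)
  typeII : ∀ (a b : Word) (i j : ℕ) → Distant i j →
           Step (a ++ i ∷ j ∷ b) (a ++ j ∷ i ∷ b)

data Path : Word → Word → Set where
  done : ∀ {u} → Path u u
  step : ∀ {u w v} → Step u w → Path w v → Path u v

len : ∀ {u v} → Path u v → ℕ
len done       = 0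
len (step _ p) = suc (len p)

countI : ∀ {u v} → Path u v → ℕ
countI done                       = 0
countI (step (typeI _ _ _ _ _) p)  = suc (countI p)
countI (step (typeII _ _ _ _ _) p) = countI p

countII : ∀ {u v} → Path u v → ℕ
countII done                       = 0
countII (step (typeI _ _ _ _ _) p)  = countII p
countII (step (typeII _ _ _ _ _) p) = suc (countII p)

-- Names.  The name of the occurrence of σ_i in u = w σ_i w'' is
-- {τ_w(i), τ_w(i+1)}, stored as the ordered pair (τ_w i , τ_w (i+1));
-- it is always compared as an unordered pair below.

Name : Set
Name = ℕ × ℕ

namesAux : (ℕ → ℕ) → Word → List Name
namesAux t []      = []
namesAux t (i ∷ w) = (t i , t (suc i)) ∷ namesAux (t ∘ swap i) w

S : Word → List Name
S u = namesAux id u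

isPair : ℕ → ℕ → Name → Bool
isPair p q (a , b) = ((a ≡ᵇ p) ∧ (b ≡ᵇ q)) ∨ ((a ≡ᵇ q) ∧ (b ≡ᵇ p))

indexOf : ℕ → ℕ → List Name → Maybe ℕ
indexOf p q []       = nothing
indexOf p q (x ∷ xs) with isPair p q x
... | true  = just 0
... | false with indexOf p q xs
...   | just k  = just (suc k)
...   | nothing = nothing

before : List Name → ℕ → ℕ → ℕ → ℕ → Bool
before s p q p' q' with indexOf p q s | indexOf p' q' s
... | just k | just l = k <ᵇ l
... | _      | _      = false

_≠ᵇ_ : Bool → Bool → Bool
true  ≠ᵇ b = not b
false ≠ᵇ b = b

orderDiffers : List Name → List Name → ℕ → ℕ → ℕ → ℕ → Bool
orderDiffers s s' p q p' q' =
  (before s p q p' q' ≠ᵇ before s' p q p' q') ∨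
  (before s p' q' p q ≠ᵇ before s' p' q' p q)

range : ℕ → List ℕ
range n = map suc (upTo n)

count : {A : Set} → (A → Bool) → List A → ℕ
count f []       = 0
count f (x ∷ xs) = if f x then suc (count f xs) else count f xs

triples : ℕ → List (ℕ × ℕ × ℕ)
triples n = concatMap (λ p → concatMap (λ q → map (λ r → (p , q , r)) (range n)) (range n)) (range n)

quads : ℕ → List ((ℕ × ℕ) × (ℕ × ℕ))
quads n = concatMap (λ pq → map (λ pq' → (pq , pq')) (pairs)) pairs
  where
  pairs : List (ℕ × ℕ)
  pairs = concatMap (λ p → map (λ q → (p , q)) (range n)) (range n)

triDiffers : List Name → List Name → ℕ → ℕ → ℕ → Bool
triDiffers s s' p q r =
  orderDiffers s s' p q p r ∨ orderDiffers s s' p q q r ∨ orderDiffers s s' p r q r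

I₃ : ℕ → List Name → List Name → ℕ
I₃ n s s' = count (λ { (p , q , r) → (p <ᵇ q) ∧ (q <ᵇ r) ∧ triDiffers s s' p q r }) (triples n)

-- unordered pairs {{p,q},{p',q'}} of disjoint 2-subsets, listed once each
-- via p < q, p' < q', p < p', and {p,q} ∩ {p',q'} = ∅
disjointPairs : ℕ → ℕ → ℕ → ℕ → Bool
disjointPairs p q p' q' =
  (p <ᵇ q) ∧ (p' <ᵇ q') ∧ (p <ᵇ p') ∧ not (q ≡ᵇ p') ∧ not (q ≡ᵇ q')

I₂₂ : ℕ → List Name → List Name → ℕ
I₂₂ n s s' = count (λ { ((p , q) , (p' , q')) → disjointPairs p q p' q' ∧ orderDiffers s s' p q p' q' }) (quads n)

module Submission where

-- For two name sequences s, s', I₃ and I₂₂ count tuples of strands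
-- on which the orders of first occurrence in s and in s' disagree.  Being counts
-- of disagreements, they vanish for s = s' and satisfy the triangle inequality,
-- so it suffices to bound the effect of one braid relation and sum along the
-- path.  The bound holds for every path.
--
-- A braid relation acts on the name sequence by permuting a block of consecutive
-- names in place: σᵢσᵢ₊₁σᵢ ↔ σᵢ₊₁σᵢσᵢ₊₁ reverses the three names {a,b}, {a,c},
-- {b,c} of three strands, and σᵢσⱼ ↔ σⱼσᵢ swaps the names {a,b}, {c,d} of four
-- distinct strands.  Permuting a block only changes the relative order of two
-- names that both occur in it.  Hence a type I relation changes the order on at
-- most one triple of strands and on no pair of disjoint pairs (four distinct
-- strands do not fit into three), while a type II relation changes the order on
-- no triple (two names sharing a strand cannot be {a,b} and {c,d}) and on at
-- most the single pair of pairs {{a,b},{c,d}}.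

open import Defs
open import Data.Nat using (ℕ; zero; suc; _+_; _≤_; _<_; _<ᵇ_; _≡ᵇ_; _≟_; z≤n; s≤s)
open import Data.Nat.Properties
open import Data.Bool using (Bool; true; false; T; T?; not; if_then_else_; _∧_; _∨_)
open import Data.Bool.Properties using (T-∨; T-∧; T-≡)
open import Data.Unit using (tt)
open import Data.Empty using (⊥; ⊥-elim)
open import Data.Maybe as Maybe using (Maybe; just; nothing)
import Data.Maybe.Properties as Maybeₚ
open import Data.List using (List; []; _∷_; _++_; length; map; concatMap; reverse; cartesianProductWith; cartesianProduct)
open import Data.List.Properties using (map-++; map-∘; concatMap-cong)
open import Data.List.Relation.Unary.All as All using (All; []; _∷_; universal)
open import Data.List.Relation.Unary.AllPairs using ([]; _∷_)
open import Data.List.Relation.Unary.Any using (Any; here; there; any?)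
open import Data.List.Relation.Unary.Unique.Propositional using (Unique)
open import Data.List.Relation.Unary.Unique.Propositional.Properties using (map⁺; upTo⁺; cartesianProduct⁺)
open import Data.List.Relation.Binary.Permutation.Propositional using (_↭_; ↭-sym; ↭-refl; ↭-swap)
open import Data.List.Relation.Binary.Permutation.Propositional.Properties using (Any-resp-↭; ↭-length; ↭-reverse)
open import Data.Product using (_×_; _,_; proj₁; proj₂; Σ-syntax)
import Data.Product as Product
open import Data.Sum using (_⊎_; inj₁; inj₂; [_,_]′)
import Data.Sum as Sum
open import Function using (_∘_; id; Equivalence)
open import Relation.Binary.PropositionalEquality
open import Relation.Nullary using (¬_; yes; no)

open Equivalence using (to; from)

∨-split : ∀ {x y x₁ x₂ y₁ y₂} → (T x → T x₁ ⊎ T x₂) → (T y → T y₁ ⊎ T y₂) →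
          T (x ∨ y) → T (x₁ ∨ y₁) ⊎ T (x₂ ∨ y₂)
∨-split f g h with to T-∨ h
... | inj₁ hx = Sum.map (from T-∨ ∘ inj₁) (from T-∨ ∘ inj₁) (f hx)
... | inj₂ hy = Sum.map (from T-∨ ∘ inj₂) (from T-∨ ∘ inj₂) (g hy)

∧-split : ∀ {g y y₁ y₂} → (T y → T y₁ ⊎ T y₂) → T (g ∧ y) → T (g ∧ y₁) ⊎ T (g ∧ y₂)
∧-split {true} f h = f h

∧-never : ∀ {g y} → ¬ T y → ¬ T (g ∧ y)
∧-never {true} ny = ny

∨-never : ∀ {x y} → ¬ T x → ¬ T y → ¬ T (x ∨ y)
∨-never nx ny = [ nx , ny ]′ ∘ to T-∨

≠ᵇ-irrefl : ∀ x → ¬ T (x ≠ᵇ x)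
≠ᵇ-irrefl true ()
≠ᵇ-irrefl false ()

≠ᵇ-triangle : ∀ x y z → T (x ≠ᵇ z) → T (x ≠ᵇ y) ⊎ T (y ≠ᵇ z)
≠ᵇ-triangle true  true  z h = inj₂ h
≠ᵇ-triangle true  false z h = inj₁ tt
≠ᵇ-triangle false true  z h = inj₁ tt
≠ᵇ-triangle false false z h = inj₂ h

if-≤ : ∀ b n → n ≤ (if b then suc n else n)
if-≤ true  n = n≤1+n n
if-≤ false n = ≤-refl

count-subadditive : ∀ {A : Set} (f g h : A → Bool) (xs : List A) →
  (∀ x → T (f x) → T (g x) ⊎ T (h x)) → count f xs ≤ count g xs + count h xs
count-subadditive f g h [] split = z≤n
count-subadditive f g h (x ∷ xs) split
  with f x | g x | h x | split x | count-subadditive f g h xs split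
... | true  | true  | c     | _  | ih = s≤s (≤-trans ih (+-monoʳ-≤ (count g xs) (if-≤ c _)))
... | true  | false | true  | _  | ih = ≤-trans (s≤s ih) (≤-reflexive (sym (+-suc (count g xs) (count h xs))))
... | true  | false | false | sx | _  = ⊥-elim ([ id , id ]′ (sx tt))
... | false | b     | c     | _  | ih = ≤-trans ih (+-mono-≤ (if-≤ b _) (if-≤ c _))

count-none : ∀ {A : Set} (f : A → Bool) {xs : List A} → All (λ x → ¬ T (f x)) xs → count f xs ≡ 0
count-none f [] = refl
count-none f {x ∷ _} (nx ∷ rest) with f x
... | true  = ⊥-elim (nx tt)
... | false = count-none f rest

count-atMostOne : ∀ {A : Set} (f : A → Bool) {xs : List A} → Unique xs →
  (∀ x y → T (f x) → T (f y) → x ≡ y) → count f xs ≤ 1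
count-atMostOne f [] same = z≤n
count-atMostOne f {x ∷ xs} (x∉xs ∷ uniq) same with f x in fx
... | true  = s≤s (≤-reflexive (count-none f (All.map (λ x≢y fy → x≢y (same x _ fxT fy)) x∉xs)))
  where
  fxT : T (f x)
  fxT = from T-≡ fx
... | false = count-atMostOne f uniq same

concatMap-map≡product : ∀ {A B C : Set} (f : A → B → C) xs ys →
  concatMap (λ x → map (f x) ys) xs ≡ cartesianProductWith f xs ys
concatMap-map≡product f []       ys = refl
concatMap-map≡product f (x ∷ xs) ys = cong (map (f x) ys ++_) (concatMap-map≡product f xs ys)

map-product : ∀ {A B C D : Set} (g : C → D) (f : A → B → C) xs ys →
  map g (cartesianProductWith f xs ys) ≡ cartesianProductWith (λ x y → g (f x y)) xs ys
map-product g f []       ys = refl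
map-product g f (x ∷ xs) ys = begin
  map g (map (f x) ys ++ cartesianProductWith f xs ys)
    ≡⟨ map-++ g (map (f x) ys) _ ⟩
  map g (map (f x) ys) ++ map g (cartesianProductWith f xs ys)
    ≡⟨ cong₂ _++_ (sym (map-∘ ys)) (map-product g f xs ys) ⟩
  map (g ∘ f x) ys ++ cartesianProductWith (λ x y → g (f x y)) xs ys ∎
  where open ≡-Reasoning

range-unique : ∀ n → Unique (range n)
range-unique n = map⁺ suc-injective (upTo⁺ n)

triples-unique : ∀ n → Unique (triples n)
triples-unique n = subst Unique (sym triples≡product)
  (cartesianProduct⁺ (range-unique n) (cartesianProduct⁺ (range-unique n) (range-unique n)))
  where
  R : List ℕ
  R = range n
  open ≡-Reasoning
  triples≡product : triples n ≡ cartesianProduct R (cartesianProduct R R)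
  triples≡product = begin
    triples n
      ≡⟨ concatMap-cong (λ p → concatMap-map≡product (λ q r → p , q , r) R R) R ⟩
    concatMap (λ p → cartesianProductWith (λ q r → p , q , r) R R) R
      ≡⟨ concatMap-cong (λ p → sym (map-product (p ,_) _,_ R R)) R ⟩
    concatMap (λ p → map (p ,_) (cartesianProduct R R)) R
      ≡⟨ concatMap-map≡product _,_ R (cartesianProduct R R) ⟩
    cartesianProduct R (cartesianProduct R R) ∎

quads-unique : ∀ n → Unique (quads n)
quads-unique n = subst Unique (sym (concatMap-map≡product _,_ P P))
  (cartesianProduct⁺ pairs-unique pairs-unique)
  where
  R : List ℕ
  R = range n
  P : List (ℕ × ℕ)
  P = concatMap (λ p → map (p ,_) R) R
  pairs-unique : Unique P
  pairs-unique = subst Unique (sym (concatMap-map≡product _,_ R R))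
    (cartesianProduct⁺ (range-unique n) (range-unique n))

orderDiffers-irrefl : ∀ s p q p' q' → ¬ T (orderDiffers s s p q p' q')
orderDiffers-irrefl s p q p' q' = ∨-never (≠ᵇ-irrefl (before s p q p' q')) (≠ᵇ-irrefl (before s p' q' p q))

orderDiffers-triangle : ∀ s₁ s₂ s₃ p q p' q' → T (orderDiffers s₁ s₃ p q p' q') →
  T (orderDiffers s₁ s₂ p q p' q') ⊎ T (orderDiffers s₂ s₃ p q p' q')
orderDiffers-triangle s₁ s₂ s₃ p q p' q' =
  ∨-split (≠ᵇ-triangle (before s₁ p q p' q') (before s₂ p q p' q') (before s₃ p q p' q'))
          (≠ᵇ-triangle (before s₁ p' q' p q) (before s₂ p' q' p q) (before s₃ p' q' p q))

triDiffers-irrefl : ∀ s p q r → ¬ T (triDiffers s s p q r)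
triDiffers-irrefl s p q r =
  ∨-never (orderDiffers-irrefl s p q p r) (∨-never (orderDiffers-irrefl s p q q r) (orderDiffers-irrefl s p r q r))

triDiffers-triangle : ∀ s₁ s₂ s₃ p q r → T (triDiffers s₁ s₃ p q r) →
  T (triDiffers s₁ s₂ p q r) ⊎ T (triDiffers s₂ s₃ p q r)
triDiffers-triangle s₁ s₂ s₃ p q r =
  ∨-split (orderDiffers-triangle s₁ s₂ s₃ p q p r)
    (∨-split (orderDiffers-triangle s₁ s₂ s₃ p q q r) (orderDiffers-triangle s₁ s₂ s₃ p r q r))

I₃-self : ∀ n s → I₃ n s s ≡ 0
I₃-self n s = count-none _ (universal (λ { (p , q , r) → uncounted p q r }) (triples n))
  where
  uncounted : ∀ p q r → ¬ T ((p <ᵇ q) ∧ (q <ᵇ r) ∧ triDiffers s s p q r)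
  uncounted p q r = ∧-never {p <ᵇ q} (∧-never {q <ᵇ r} (triDiffers-irrefl s p q r))

I₂₂-self : ∀ n s → I₂₂ n s s ≡ 0
I₂₂-self n s = count-none _ (universal (λ { ((p , q) , (p' , q')) → uncounted p q p' q' }) (quads n))
  where
  uncounted : ∀ p q p' q' → ¬ T (disjointPairs p q p' q' ∧ orderDiffers s s p q p' q')
  uncounted p q p' q' = ∧-never {disjointPairs p q p' q'} (orderDiffers-irrefl s p q p' q')

I₃-triangle : ∀ n s₁ s₂ s₃ → I₃ n s₁ s₃ ≤ I₃ n s₁ s₂ + I₃ n s₂ s₃
I₃-triangle n s₁ s₂ s₃ = count-subadditive _ _ _ (triples n)
  λ { (p , q , r) → ∧-split {p <ᵇ q} (∧-split {q <ᵇ r} (triDiffers-triangle s₁ s₂ s₃ p q r)) }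

I₂₂-triangle : ∀ n s₁ s₂ s₃ → I₂₂ n s₁ s₃ ≤ I₂₂ n s₁ s₂ + I₂₂ n s₂ s₃
I₂₂-triangle n s₁ s₂ s₃ = count-subadditive _ _ _ (quads n)
  λ { ((p , q) , (p' , q')) → ∧-split {disjointPairs p q p' q'} (orderDiffers-triangle s₁ s₂ s₃ p q p' q') }

Occurs : ℕ → ℕ → List Name → Set
Occurs p q = Any (λ x → T (isPair p q x))

indexOf-hit : ∀ p q x xs → T (isPair p q x) → indexOf p q (x ∷ xs) ≡ just 0
indexOf-hit p q x xs h with isPair p q x
... | true = refl

indexOf-miss : ∀ p q x xs → ¬ T (isPair p q x) → indexOf p q (x ∷ xs) ≡ Maybe.map suc (indexOf p q xs)
indexOf-miss p q x xs miss with isPair p q x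
... | true = ⊥-elim (miss tt)
... | false with indexOf p q xs
...   | just k  = refl
...   | nothing = refl

indexOf-++-found : ∀ p q P → Occurs p q P →
  Σ[ k ∈ ℕ ] k < length P × (∀ R → indexOf p q (P ++ R) ≡ just k)
indexOf-++-found p q (x ∷ P) (here h) = 0 , s≤s z≤n , λ R → indexOf-hit p q x (P ++ R) h
indexOf-++-found p q (x ∷ P) (there o) with T? (isPair p q x)
... | yes h = 0 , s≤s z≤n , λ R → indexOf-hit p q x (P ++ R) h
... | no miss with indexOf-++-found p q P o
...   | k , k<P , found = suc k , s≤s k<P , λ R →
        trans (indexOf-miss p q x (P ++ R) miss) (cong (Maybe.map suc) (found R))

indexOf-++-skip : ∀ p q P R → ¬ Occurs p q P →
  indexOf p q (P ++ R) ≡ Maybe.map (length P +_) (indexOf p q R)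
indexOf-++-skip p q [] R _ = sym (Maybeₚ.map-id (indexOf p q R))
indexOf-++-skip p q (x ∷ P) R absent = begin
  indexOf p q (x ∷ P ++ R)
    ≡⟨ indexOf-miss p q x (P ++ R) (absent ∘ here) ⟩
  Maybe.map suc (indexOf p q (P ++ R))
    ≡⟨ cong (Maybe.map suc) (indexOf-++-skip p q P R (absent ∘ there)) ⟩
  Maybe.map suc (Maybe.map (length P +_) (indexOf p q R))
    ≡⟨ Maybeₚ.map-∘ (indexOf p q R) ⟨
  Maybe.map (suc (length P) +_) (indexOf p q R) ∎
  where open ≡-Reasoning

precedes : Maybe ℕ → Maybe ℕ → Bool
precedes (just k) (just l) = k <ᵇ l
precedes _        _        = false

before-precedes : ∀ s p q p' q' → before s p q p' q' ≡ precedes (indexOf p q s) (indexOf p' q' s)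
before-precedes s p q p' q' with indexOf p q s | indexOf p' q' s
... | just k  | just l  = refl
... | just k  | nothing = refl
... | nothing | _       = refl

<ᵇ-true : ∀ {k l} → k < l → (k <ᵇ l) ≡ true
<ᵇ-true k<l = to T-≡ (<⇒<ᵇ k<l)

<ᵇ-false : ∀ {k l} → l ≤ k → (k <ᵇ l) ≡ false
<ᵇ-false {k} {l} l≤k with k <ᵇ l in e
... | true  = ⊥-elim (<⇒≱ (<ᵇ⇒< k l (from T-≡ e)) l≤k)
... | false = refl

-- Where the first occurrence of a pair lies relative to a window [L, H) of positions:
-- either at the same place in both sequences outside the window (or nowhere), or
-- inside the window in both sequences, which requires evidence A (that the pair
-- occurs in the window).
Within : ℕ → ℕ → ℕ → Set
Within L H k = L ≤ k × k < H

data Fixed (L H : ℕ) : Maybe ℕ → Set where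
  absent : Fixed L H nothing
  left   : ∀ {k} → k < L → Fixed L H (just k)
  right  : ∀ {k} → H ≤ k → Fixed L H (just k)

data Located (L H : ℕ) (A : Set) : Maybe ℕ → Maybe ℕ → Set where
  fixed : ∀ {m} → Fixed L H m → Located L H A m m
  moved : ∀ {k k'} → A → Within L H k → Within L H k' → Located L H A (just k) (just k')

fixed-before-window : ∀ {L H m k k'} → Fixed L H m → Within L H k → Within L H k' →
  precedes m (just k) ≡ precedes m (just k')
fixed-before-window absent       _              _                = refl
fixed-before-window (left  i<L)  (L≤k , _)      (L≤k' , _)       =
  trans (<ᵇ-true (<-≤-trans i<L L≤k)) (sym (<ᵇ-true (<-≤-trans i<L L≤k')))
fixed-before-window (right H≤i)  (_ , k<H)      (_ , k'<H)       =
  trans (<ᵇ-false (≤-trans (<⇒≤ k<H) H≤i)) (sym (<ᵇ-false (≤-trans (<⇒≤ k'<H) H≤i)))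

window-before-fixed : ∀ {L H m k k'} → Within L H k → Within L H k' → Fixed L H m →
  precedes (just k) m ≡ precedes (just k') m
window-before-fixed _           _            absent      = refl
window-before-fixed (L≤k , _)   (L≤k' , _)   (left i<L)  =
  trans (<ᵇ-false (≤-trans (<⇒≤ i<L) L≤k)) (sym (<ᵇ-false (≤-trans (<⇒≤ i<L) L≤k')))
window-before-fixed (_ , k<H)   (_ , k'<H)   (right H≤i) =
  trans (<ᵇ-true (<-≤-trans k<H H≤i)) (sym (<ᵇ-true (<-≤-trans k'<H H≤i)))

order-changes-inside : ∀ {L H A B m₁ m₁' m₂ m₂'} → Located L H A m₁ m₁' → Located L H B m₂ m₂' →
  T (precedes m₁ m₂ ≠ᵇ precedes m₁' m₂') → A × B
order-changes-inside (fixed {m₁} _) (fixed {m₂} _) h = ⊥-elim (≠ᵇ-irrefl (precedes m₁ m₂) h)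
order-changes-inside (fixed {m₁} f) (moved {k' = k'} _ w w') h
  rewrite fixed-before-window f w w' = ⊥-elim (≠ᵇ-irrefl (precedes m₁ (just k')) h)
order-changes-inside (moved {k' = k'} _ w w') (fixed {m₂} f) h
  rewrite window-before-fixed w w' f = ⊥-elim (≠ᵇ-irrefl (precedes (just k') m₂) h)
order-changes-inside (moved a _ _) (moved b _ _) h = a , b

module BlockRearrangement (P W W' Q : List Name) (perm : W ↭ W') where

  private
    L H : ℕ
    L = length P
    H = length P + length W

  locate : ∀ p q → Located L H (Occurs p q W) (indexOf p q (P ++ W ++ Q)) (indexOf p q (P ++ W' ++ Q))
  locate p q with any? (λ x → T? (isPair p q x)) P
  ... | yes ∈P with indexOf-++-found p q P ∈P
  ...   | k , k<L , found rewrite found (W ++ Q) | found (W' ++ Q) = fixed (left k<L)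
  locate p q | no ∉P
    rewrite indexOf-++-skip p q P (W ++ Q) ∉P | indexOf-++-skip p q P (W' ++ Q) ∉P
    with any? (λ x → T? (isPair p q x)) W
  ... | yes ∈W with indexOf-++-found p q W ∈W | indexOf-++-found p q W' (Any-resp-↭ perm ∈W)
  ...   | k , k<W , found | k' , k'<W' , found' rewrite found Q | found' Q =
          moved ∈W (m≤m+n L k , +-monoʳ-< L k<W)
                   (m≤m+n L k' , +-monoʳ-< L (subst (k' <_) (sym (↭-length perm)) k'<W'))
  locate p q | no ∉P | no ∉W
    rewrite indexOf-++-skip p q W Q ∉W | indexOf-++-skip p q W' Q (∉W ∘ Any-resp-↭ (↭-sym perm))
          | sym (↭-length perm)
    with indexOf p q Q
  ... | nothing = fixed absent
  ... | just k  = fixed (right (+-monoʳ-≤ L (m≤m+n (length W) k)))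

  order-change-in-block : ∀ p q p' q' → T (orderDiffers (P ++ W ++ Q) (P ++ W' ++ Q) p q p' q') →
    Occurs p q W × Occurs p' q' W
  order-change-in-block p q p' q' h
    rewrite before-precedes (P ++ W ++ Q) p q p' q' | before-precedes (P ++ W' ++ Q) p q p' q'
          | before-precedes (P ++ W ++ Q) p' q' p q | before-precedes (P ++ W' ++ Q) p' q' p q
    with to T-∨ h
  ... | inj₁ pq-first = order-changes-inside (locate p q) (locate p' q') pq-first
  ... | inj₂ p'q'-first = Product.swap (order-changes-inside (locate p' q') (locate p q) p'q'-first)

swap-suc : ∀ i x → swap (suc i) (suc x) ≡ suc (swap i x)
swap-suc i x with x ≡ᵇ i
... | true = refl
... | false with x ≡ᵇ suc i
...   | true  = refl
...   | false = refl

swap-involutive : ∀ i x → swap i (swap i x) ≡ x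
swap-involutive zero    zero                = refl
swap-involutive zero    (suc zero)          = refl
swap-involutive zero    (suc (suc x))       = refl
swap-involutive (suc i) zero                = refl
swap-involutive (suc i) (suc x)
  rewrite swap-suc i x | swap-suc i (swap i x) = cong suc (swap-involutive i x)

swap-injective : ∀ i {x y} → swap i x ≡ swap i y → x ≡ y
swap-injective i {x} {y} e = begin
  x                 ≡⟨ swap-involutive i x ⟨
  swap i (swap i x) ≡⟨ cong (swap i) e ⟩
  swap i (swap i y) ≡⟨ swap-involutive i y ⟩
  y                 ∎
  where open ≡-Reasoning

swap-fixes : ∀ i x → suc (suc i) ≤ x ⊎ suc x ≤ i → swap i x ≡ x
swap-fixes zero    zero          (inj₁ ())
swap-fixes zero    (suc zero)    (inj₁ (s≤s ()))
swap-fixes zero    (suc (suc x)) _               = refl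
swap-fixes (suc i) zero          _               = refl
swap-fixes (suc i) (suc x)       (inj₁ (s≤s h))  rewrite swap-suc i x = cong suc (swap-fixes i x (inj₁ h))
swap-fixes (suc i) (suc x)       (inj₂ (s≤s h))  rewrite swap-suc i x = cong suc (swap-fixes i x (inj₂ h))

swap-left : ∀ i → swap i i ≡ suc i
swap-left zero    = refl
swap-left (suc i) rewrite swap-suc i i = cong suc (swap-left i)

swap-right : ∀ i → swap i (suc i) ≡ i
swap-right zero    = refl
swap-right (suc i) rewrite swap-suc i (suc i) = cong suc (swap-right i)

swap-braid : ∀ i x → swap i (swap (suc i) (swap i x)) ≡ swap (suc i) (swap i (swap (suc i) x))
swap-braid zero    zero                      = refl
swap-braid zero    (suc zero)                = refl
swap-braid zero    (suc (suc zero))          = refl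
swap-braid zero    (suc (suc (suc x)))       = refl
swap-braid (suc i) zero                      = refl
swap-braid (suc i) (suc x)
  rewrite swap-suc i x | swap-suc (suc i) (swap i x) | swap-suc i (swap (suc i) (swap i x))
        | swap-suc (suc i) x | swap-suc i (swap (suc i) x) | swap-suc (suc i) (swap i (swap (suc i) x))
  = cong suc (swap-braid i x)

swap-comm : ∀ i j x → suc (suc i) ≤ j → swap i (swap j x) ≡ swap j (swap i x)
swap-comm zero    (suc (suc j)) zero          _ = refl
swap-comm zero    (suc (suc j)) (suc zero)    _ = refl
swap-comm zero    (suc (suc j)) (suc (suc x)) _ rewrite swap-suc (suc j) (suc x) | swap-suc j x = refl
swap-comm zero    (suc zero)    _             (s≤s ())
swap-comm (suc i) (suc j)       zero          _ = refl
swap-comm (suc i) (suc j)       (suc x)       (s≤s h)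
  rewrite swap-suc j x | swap-suc i (swap j x) | swap-suc i x | swap-suc j (swap i x)
  = cong suc (swap-comm i j x h)

tau-injective : ∀ w {x y} → tau w x ≡ tau w y → x ≡ y
tau-injective []      e = e
tau-injective (i ∷ w) e = tau-injective w (swap-injective i e)

namesAux-++ : ∀ t a w → namesAux t (a ++ w) ≡ namesAux t a ++ namesAux (t ∘ tau a) w
namesAux-++ t []      w = refl
namesAux-++ t (i ∷ a) w = cong (_ ∷_) (namesAux-++ (t ∘ swap i) a w)

namesAux-cong : ∀ {f g} w → (∀ x → f x ≡ g x) → namesAux f w ≡ namesAux g w
namesAux-cong []      f≗g = refl
namesAux-cong (i ∷ w) f≗g =
  cong₂ _∷_ (cong₂ _,_ (f≗g i) (f≗g (suc i))) (namesAux-cong w (f≗g ∘ swap i))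

Triangle : ℕ → ℕ → ℕ → List Name
Triangle a b c = (a , b) ∷ (a , c) ∷ (b , c) ∷ []

names-ascending : ∀ t i w → namesAux t (i ∷ suc i ∷ i ∷ w) ≡
  Triangle (t i) (t (suc i)) (t (suc (suc i))) ++ namesAux (t ∘ swap i ∘ swap (suc i) ∘ swap i) w
names-ascending t i w
  rewrite swap-fixes (suc i) i (inj₂ ≤-refl) | swap-left (suc i)
        | swap-left i | swap-right i | swap-fixes i (suc (suc i)) (inj₁ ≤-refl) = refl

names-descending : ∀ t i w → namesAux t (suc i ∷ i ∷ suc i ∷ w) ≡
  reverse (Triangle (t i) (t (suc i)) (t (suc (suc i)))) ++ namesAux (t ∘ swap i ∘ swap (suc i) ∘ swap i) w
names-descending t i w
  rewrite swap-right i | swap-fixes i (suc (suc i)) (inj₁ ≤-refl)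
        | swap-fixes (suc i) i (inj₂ ≤-refl) | swap-left (suc i) | swap-right (suc i)
  = cong (reverse (Triangle (t i) (t (suc i)) (t (suc (suc i)))) ++_)
         (namesAux-cong w (λ x → cong t (sym (swap-braid i x))))

data _≐_ : ℕ × ℕ → Name → Set where
  direct  : ∀ {p q} → (p , q) ≐ (p , q)
  flipped : ∀ {p q} → (p , q) ≐ (q , p)

isPair-sound : ∀ p q x → T (isPair p q x) → (p , q) ≐ x
isPair-sound p q (a , b) h with to T-∨ h
... | inj₁ h₁ with to T-∧ h₁
...   | a≡p , b≡q rewrite ≡ᵇ⇒≡ a p a≡p | ≡ᵇ⇒≡ b q b≡q = direct
isPair-sound p q (a , b) h | inj₂ h₂ with to T-∧ h₂
...   | a≡q , b≡p rewrite ≡ᵇ⇒≡ a q a≡q | ≡ᵇ⇒≡ b p b≡p = flipped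

≐-flip : ∀ {p q x} → (p , q) ≐ x → (q , p) ≐ x
≐-flip direct  = flipped
≐-flip flipped = direct

≐-shared : ∀ {x y z n} → (x , y) ≐ n → (x , z) ≐ n → y ≡ z
≐-shared direct  direct  = refl
≐-shared direct  flipped = refl
≐-shared flipped direct  = refl
≐-shared flipped flipped = refl

≐-increasing : ∀ {p q p' q' n} → (p , q) ≐ n → (p' , q') ≐ n → p < q → p' < q' → p ≡ p' × q ≡ q'
≐-increasing direct  direct  _   _   = refl , refl
≐-increasing flipped flipped _   _   = refl , refl
≐-increasing direct  flipped p<q q<p = ⊥-elim (<-asym p<q q<p)
≐-increasing flipped direct  q<p p<q = ⊥-elim (<-asym p<q q<p)

data Among (a b c : ℕ) : ℕ → Set where
  is-a : Among a b c a
  is-b : Among a b c b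
  is-c : Among a b c c

SpansThree : ℕ → ℕ → ℕ → List Name → Set
SpansThree a b c W = ∀ {p q} → Occurs p q W → Among a b c p × Among a b c q

name-among : ∀ {a b c p q x y} → (p , q) ≐ (x , y) → Among a b c x → Among a b c y →
  Among a b c p × Among a b c q
name-among direct  x y = x , y
name-among flipped x y = y , x

triangle-spans : ∀ a b c → SpansThree a b c (Triangle a b c)
triangle-spans a b c (here h)                 = name-among (isPair-sound _ _ _ h) is-a is-b
triangle-spans a b c (there (here h))         = name-among (isPair-sound _ _ _ h) is-a is-c
triangle-spans a b c (there (there (here h))) = name-among (isPair-sound _ _ _ h) is-b is-c

reversed-triangle-spans : ∀ a b c → SpansThree a b c (reverse (Triangle a b c))
reversed-triangle-spans a b c = triangle-spans a b c ∘ Any-resp-↭ (↭-reverse (Triangle a b c))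

record BlockMove (W s s' : List Name) : Set where
  field
    prefix suffix permuted : List Name
    permutation : W ↭ permuted
    source : s ≡ prefix ++ W ++ suffix
    target : s' ≡ prefix ++ permuted ++ suffix

order-change-in-move : ∀ {W s s'} → BlockMove W s s' → ∀ p q p' q' →
  T (orderDiffers s s' p q p' q') → Occurs p q W × Occurs p' q' W
order-change-in-move {W} m p q p' q' rewrite BlockMove.source m | BlockMove.target m =
  BlockRearrangement.order-change-in-block
    (BlockMove.prefix m) W (BlockMove.permuted m) (BlockMove.suffix m) (BlockMove.permutation m) p q p' q'

record ThreeStrandMove (s s' : List Name) : Set where
  field
    a b c : ℕ
    block : List Name
    move  : BlockMove block s s'
    spans : SpansThree a b c block

typeI-move : ∀ pre post i j → Adjacent i j →
  ThreeStrandMove (S (pre ++ i ∷ j ∷ i ∷ post)) (S (pre ++ j ∷ i ∷ j ∷ post))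
typeI-move pre post i .(suc i) (inj₂ refl) = record
  { a = t i ; b = t (suc i) ; c = t (suc (suc i)) ; block = triangle
  ; move = record
    { prefix = S pre ; suffix = rest ; permuted = reverse triangle
    ; permutation = ↭-sym (↭-reverse triangle)
    ; source = trans (namesAux-++ id pre _) (cong (S pre ++_) (names-ascending t i post))
    ; target = trans (namesAux-++ id pre _) (cong (S pre ++_) (names-descending t i post)) }
  ; spans = triangle-spans (t i) (t (suc i)) (t (suc (suc i))) }
  where
  t : ℕ → ℕ
  t = tau pre
  triangle : List Name
  triangle = Triangle (t i) (t (suc i)) (t (suc (suc i)))
  rest : List Name
  rest = namesAux (t ∘ swap i ∘ swap (suc i) ∘ swap i) post
typeI-move pre post .(suc j) j (inj₁ refl) = record
  { a = t j ; b = t (suc j) ; c = t (suc (suc j)) ; block = reverse triangle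
  ; move = record
    { prefix = S pre ; suffix = rest ; permuted = triangle
    ; permutation = ↭-reverse triangle
    ; source = trans (namesAux-++ id pre _) (cong (S pre ++_) (names-descending t j post))
    ; target = trans (namesAux-++ id pre _) (cong (S pre ++_) (names-ascending t j post)) }
  ; spans = reversed-triangle-spans (t j) (t (suc j)) (t (suc (suc j))) }
  where
  t : ℕ → ℕ
  t = tau pre
  triangle : List Name
  triangle = Triangle (t j) (t (suc j)) (t (suc (suc j)))
  rest : List Name
  rest = namesAux (t ∘ swap j ∘ swap (suc j) ∘ swap j) post

distant-apart : ∀ {i j} → Distant i j → i ≢ j × i ≢ suc j × suc i ≢ j × suc i ≢ suc j
distant-apart {i} {j} (inj₁ 1+i<j) =
  <⇒≢ i<j , <⇒≢ (m<n⇒m<1+n i<j) , <⇒≢ 1+i<j , <⇒≢ (m<n⇒m<1+n 1+i<j)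
  where
  i<j : i < j
  i<j = <-trans (n<1+n i) 1+i<j
distant-apart {i} {j} (inj₂ 1+j<i) =
  ≢-sym (<⇒≢ j<i) , ≢-sym (<⇒≢ 1+j<i) ,
  ≢-sym (<⇒≢ (m<n⇒m<1+n j<i)) , ≢-sym (<⇒≢ (m<n⇒m<1+n 1+j<i))
  where
  j<i : j < i
  j<i = <-trans (n<1+n j) 1+j<i

distant-sym : ∀ {i j} → Distant i j → Distant j i
distant-sym (inj₁ h) = inj₂ h
distant-sym (inj₂ h) = inj₁ h

swap-comm-distant : ∀ {i j} → Distant i j → ∀ x → swap i (swap j x) ≡ swap j (swap i x)
swap-comm-distant {i} {j} (inj₁ h) x = swap-comm i j x h
swap-comm-distant {i} {j} (inj₂ h) x = sym (swap-comm j i x h)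

names-distant : ∀ t i j w → Distant i j →
  namesAux t (i ∷ j ∷ w) ≡ (t i , t (suc i)) ∷ (t j , t (suc j)) ∷ namesAux (t ∘ swap i ∘ swap j) w
names-distant t i j w (inj₁ h)
  rewrite swap-fixes i j (inj₁ h) | swap-fixes i (suc j) (inj₁ (m≤n⇒m≤1+n h)) = refl
names-distant t i j w (inj₂ h)
  rewrite swap-fixes i j (inj₂ (<⇒≤ h)) | swap-fixes i (suc j) (inj₂ h) = refl

Apart : ℕ → ℕ → ℕ → ℕ → Set
Apart a b c d = a ≢ c × a ≢ d × b ≢ c × b ≢ d

record TwoPairMove (s s' : List Name) : Set where
  field
    a b c d : ℕ
    move  : BlockMove ((a , b) ∷ (c , d) ∷ []) s s'
    apart : Apart a b c d

typeII-move : ∀ pre post i j → Distant i j →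
  TwoPairMove (S (pre ++ i ∷ j ∷ post)) (S (pre ++ j ∷ i ∷ post))
typeII-move pre post i j dist = record
  { a = t i ; b = t (suc i) ; c = t j ; d = t (suc j)
  ; move = record
    { prefix = S pre ; suffix = namesAux (t ∘ swap i ∘ swap j) post
    ; permuted = (t j , t (suc j)) ∷ (t i , t (suc i)) ∷ []
    ; permutation = ↭-swap _ _ ↭-refl
    ; source = trans (namesAux-++ id pre _) (cong (S pre ++_) (names-distant t i j post dist))
    ; target = trans (namesAux-++ id pre _) (cong (S pre ++_) (trans (names-distant t j i post (distant-sym dist))
                 (cong (λ r → (t j , t (suc j)) ∷ (t i , t (suc i)) ∷ r)
                       (namesAux-cong post (λ x → cong t (sym (swap-comm-distant dist x))))))) }
  ; apart = Product.map (_∘ tau-injective pre) (Product.map (_∘ tau-injective pre)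
             (Product.map (_∘ tau-injective pre) (_∘ tau-injective pre))) (distant-apart dist) }
  where
  t : ℕ → ℕ
  t = tau pre

pigeonhole : ∀ {a b c w x y z} → Among a b c w → Among a b c x → Among a b c y → Among a b c z →
  w ≢ x → w ≢ y → w ≢ z → x ≢ y → x ≢ z → y ≢ z → ⊥
pigeonhole is-a is-a _    _    wx _  _  _  _  _  = wx refl
pigeonhole is-b is-b _    _    wx _  _  _  _  _  = wx refl
pigeonhole is-c is-c _    _    wx _  _  _  _  _  = wx refl
pigeonhole is-a _    is-a _    _  wy _  _  _  _  = wy refl
pigeonhole is-b _    is-b _    _  wy _  _  _  _  = wy refl
pigeonhole is-c _    is-c _    _  wy _  _  _  _  = wy refl
pigeonhole is-a _    _    is-a _  _  wz _  _  _  = wz refl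
pigeonhole is-b _    _    is-b _  _  wz _  _  _  = wz refl
pigeonhole is-c _    _    is-c _  _  wz _  _  _  = wz refl
pigeonhole _    is-a is-a _    _  _  _  xy _  _  = xy refl
pigeonhole _    is-b is-b _    _  _  _  xy _  _  = xy refl
pigeonhole _    is-c is-c _    _  _  _  xy _  _  = xy refl
pigeonhole _    is-a _    is-a _  _  _  _  xz _  = xz refl
pigeonhole _    is-b _    is-b _  _  _  _  xz _  = xz refl
pigeonhole _    is-c _    is-c _  _  _  _  xz _  = xz refl
pigeonhole _    _    is-a is-a _  _  _  _  _  yz = yz refl
pigeonhole _    _    is-b is-b _  _  _  _  _  yz = yz refl
pigeonhole _    _    is-c is-c _  _  _  _  _  yz = yz refl

increasing-covers : ∀ {a b c x y z w} → x < y → y < z →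
  Among a b c x → Among a b c y → Among a b c z → Among a b c w → Among x y z w
increasing-covers {x = x} {y} {z} {w} x<y y<z ax ay az aw with w ≟ x | w ≟ y | w ≟ z
... | yes refl | _        | _        = is-a
... | no _     | yes refl | _        = is-b
... | no _     | no _     | yes refl = is-c
... | no w≢x   | no w≢y   | no w≢z   =
  ⊥-elim (pigeonhole aw ax ay az w≢x w≢y w≢z (<⇒≢ x<y) (<⇒≢ (<-trans x<y y<z)) (<⇒≢ y<z))

among-between : ∀ {x y z w} → x < y → y < z → Among x y z w → x ≤ w × w ≤ z
among-between x<y y<z is-a = ≤-refl , <⇒≤ (<-trans x<y y<z)
among-between x<y y<z is-b = <⇒≤ x<y , <⇒≤ y<z
among-between x<y y<z is-c = <⇒≤ (<-trans x<y y<z) , ≤-refl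

same-middle : ∀ {x y z x' y' z'} → x ≡ x' → z ≡ z' → x' < y' → y' < z' → Among x y z y' → y ≡ y'
same-middle refl _    x<x _   is-a = ⊥-elim (<-irrefl refl x<x)
same-middle _    _    _   _   is-b = refl
same-middle _    refl _   z<z is-c = ⊥-elim (<-irrefl refl z<z)

increasing-unique : ∀ {a b c p q r p' q' r'} → p < q → q < r → p' < q' → q' < r' →
  Among a b c p → Among a b c q → Among a b c r →
  Among a b c p' → Among a b c q' → Among a b c r' → (p , q , r) ≡ (p' , q' , r')
increasing-unique {a} {b} {c} {p} {q} {r} {p'} {q'} {r'} p<q q<r p'<q' q'<r' ap aq ar ap' aq' ar' =
  cong₂ _,_ p≡p' (cong₂ _,_ (same-middle p≡p' r≡r' p'<q' q'<r' (cover aq')) r≡r')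
  where
  cover : ∀ {w} → Among a b c w → Among p q r w
  cover = increasing-covers p<q q<r ap aq ar
  cover' : ∀ {w} → Among a b c w → Among p' q' r' w
  cover' = increasing-covers p'<q' q'<r' ap' aq' ar'
  p≡p' : p ≡ p'
  p≡p' = ≤-antisym (proj₁ (among-between p<q q<r (cover ap'))) (proj₁ (among-between p'<q' q'<r' (cover' ap)))
  r≡r' : r ≡ r'
  r≡r' = ≤-antisym (proj₂ (among-between p'<q' q'<r' (cover' ar))) (proj₂ (among-between p<q q<r (cover ar')))

increasing-sound : ∀ p q r {x} → T ((p <ᵇ q) ∧ (q <ᵇ r) ∧ x) → p < q × q < r × T x
increasing-sound p q r h with to T-∧ h
... | p<q , h' with to T-∧ h'
...   | q<r , hx = <ᵇ⇒< p q p<q , <ᵇ⇒< q r q<r , hx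

≢-from-not-≡ᵇ : ∀ m n → T (not (m ≡ᵇ n)) → m ≢ n
≢-from-not-≡ᵇ m n h m≡n with m ≡ᵇ n | ≡⇒≡ᵇ m n m≡n
... | true | _ = h

disjointPairs-sound : ∀ p q p' q' → T (disjointPairs p q p' q') →
  p < q × p' < q' × p < p' × q ≢ p' × q ≢ q'
disjointPairs-sound p q p' q' h with to T-∧ h
... | p<q , h₁ with to T-∧ h₁
...   | p'<q' , h₂ with to T-∧ h₂
...     | p<p' , h₃ with to T-∧ h₃
...       | q≠p' , q≠q' =
  <ᵇ⇒< p q p<q , <ᵇ⇒< p' q' p'<q' , <ᵇ⇒< p p' p<p' ,
  ≢-from-not-≡ᵇ q p' q≠p' , ≢-from-not-≡ᵇ q q' q≠q'

triDiffers-cases : ∀ s s' p q r → T (triDiffers s s' p q r) →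
  T (orderDiffers s s' p q p r) ⊎ T (orderDiffers s s' p q q r) ⊎ T (orderDiffers s s' p r q r)
triDiffers-cases s s' p q r h = Sum.map₂ (to T-∨) (to T-∨ h)

module ThreeStrand {s s' : List Name} (m : ThreeStrandMove s s') where
  open ThreeStrandMove m

  changed-among : ∀ p q p' q' → T (orderDiffers s s' p q p' q') →
    (Among a b c p × Among a b c q) × (Among a b c p' × Among a b c q')
  changed-among p q p' q' h = Product.map spans spans (order-change-in-move move p q p' q' h)

  I₂₂-unchanged : ∀ n → I₂₂ n s s' ≡ 0
  I₂₂-unchanged n = count-none _ (universal (λ { ((p , q) , (p' , q')) → unchanged p q p' q' }) (quads n))
    where
    unchanged : ∀ p q p' q' → ¬ T (disjointPairs p q p' q' ∧ orderDiffers s s' p q p' q')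
    unchanged p q p' q' h with to T-∧ h
    ... | disjoint , changed with disjointPairs-sound p q p' q' disjoint | changed-among p q p' q' changed
    ...   | p<q , p'<q' , p<p' , q≢p' , q≢q' | (ap , aq) , (ap' , aq') =
      pigeonhole ap aq ap' aq' (<⇒≢ p<q) (<⇒≢ p<p') (<⇒≢ (<-trans p<p' p'<q')) q≢p' q≢q' (<⇒≢ p'<q')

  triple-among : ∀ p q r → T (triDiffers s s' p q r) → Among a b c p × Among a b c q × Among a b c r
  triple-among p q r h with triDiffers-cases s s' p q r h
  ... | inj₁ changed with changed-among p q p r changed
  ...   | (ap , aq) , (_ , ar) = ap , aq , ar
  triple-among p q r h | inj₂ (inj₁ changed) with changed-among p q q r changed
  ...   | (ap , aq) , (_ , ar) = ap , aq , ar
  triple-among p q r h | inj₂ (inj₂ changed) with changed-among p r q r changed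
  ...   | (ap , ar) , (aq , _) = ap , aq , ar

  I₃-atMostOne : ∀ n → I₃ n s s' ≤ 1
  I₃-atMostOne n = count-atMostOne _ (triples-unique n)
    λ { (p , q , r) (p' , q' , r') h h' → same-triple p q r p' q' r' h h' }
    where
    same-triple : ∀ p q r p' q' r' →
      T ((p <ᵇ q) ∧ (q <ᵇ r) ∧ triDiffers s s' p q r) →
      T ((p' <ᵇ q') ∧ (q' <ᵇ r') ∧ triDiffers s s' p' q' r') →
      (p , q , r) ≡ (p' , q' , r')
    same-triple p q r p' q' r' h h'
      with increasing-sound p q r h | increasing-sound p' q' r' h'
    ... | p<q , q<r , changed | p'<q' , q'<r' , changed'
      with triple-among p q r changed | triple-among p' q' r' changed'
    ...   | ap , aq , ar | ap' , aq' , ar' = increasing-unique p<q q<r p'<q' q'<r' ap aq ar ap' aq' ar'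

BlockName : ℕ → ℕ → ℕ → ℕ → ℕ × ℕ → Set
BlockName a b c d pq = pq ≐ (a , b) ⊎ pq ≐ (c , d)

block-name : ∀ {a b c d p q} → Occurs p q ((a , b) ∷ (c , d) ∷ []) → BlockName a b c d (p , q)
block-name (here h)         = inj₁ (isPair-sound _ _ _ h)
block-name (there (here h)) = inj₂ (isPair-sound _ _ _ h)

blockName-flip : ∀ {a b c d p q} → BlockName a b c d (p , q) → BlockName a b c d (q , p)
blockName-flip = Sum.map ≐-flip ≐-flip

apart-names : ∀ {a b c d x y z} → Apart a b c d → (x , y) ≐ (a , b) → (x , z) ≐ (c , d) → ⊥
apart-names (a≢c , _   , _   , _  ) direct  direct  = a≢c refl
apart-names (_   , a≢d , _   , _  ) direct  flipped = a≢d refl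
apart-names (_   , _   , b≢c , _  ) flipped direct  = b≢c refl
apart-names (_   , _   , _   , b≢d) flipped flipped = b≢d refl

block-shared : ∀ {a b c d x y z} → Apart a b c d →
  BlockName a b c d (x , y) → BlockName a b c d (x , z) → y ≡ z
block-shared apart (inj₁ n₁) (inj₁ n₂) = ≐-shared n₁ n₂
block-shared apart (inj₂ n₁) (inj₂ n₂) = ≐-shared n₁ n₂
block-shared apart (inj₁ n₁) (inj₂ n₂) = ⊥-elim (apart-names apart n₁ n₂)
block-shared apart (inj₂ n₁) (inj₁ n₂) = ⊥-elim (apart-names apart n₂ n₁)

Orientation : ℕ → ℕ → ℕ → ℕ → ℕ → ℕ → ℕ → ℕ → Set
Orientation a b c d p q p' q' =
  ((p , q) ≐ (a , b) × (p' , q') ≐ (c , d)) ⊎ ((p , q) ≐ (c , d) × (p' , q') ≐ (a , b))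

orientation : ∀ {a b c d p q p' q'} → BlockName a b c d (p , q) → BlockName a b c d (p' , q') →
  p < q → p' < q' → p < p' → Orientation a b c d p q p' q'
orientation (inj₁ n₁) (inj₂ n₂) _ _ _ = inj₁ (n₁ , n₂)
orientation (inj₂ n₁) (inj₁ n₂) _ _ _ = inj₂ (n₁ , n₂)
orientation (inj₁ n₁) (inj₁ n₂) p<q p'<q' p<p' =
  ⊥-elim (<⇒≢ p<p' (proj₁ (≐-increasing n₁ n₂ p<q p'<q')))
orientation (inj₂ n₁) (inj₂ n₂) p<q p'<q' p<p' =
  ⊥-elim (<⇒≢ p<p' (proj₁ (≐-increasing n₁ n₂ p<q p'<q')))

orientation-unique : ∀ {a b c d p q p' q' r s r' s'} →
  p < q → p' < q' → p < p' → r < s → r' < s' → r < r' →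
  Orientation a b c d p q p' q' → Orientation a b c d r s r' s' →
  ((p , q) , (p' , q')) ≡ ((r , s) , (r' , s'))
orientation-unique p<q p'<q' _ r<s r'<s' _ (inj₁ (n₁ , n₂)) (inj₁ (m₁ , m₂))
  with ≐-increasing n₁ m₁ p<q r<s | ≐-increasing n₂ m₂ p'<q' r'<s'
... | refl , refl | refl , refl = refl
orientation-unique p<q p'<q' _ r<s r'<s' _ (inj₂ (n₁ , n₂)) (inj₂ (m₁ , m₂))
  with ≐-increasing n₁ m₁ p<q r<s | ≐-increasing n₂ m₂ p'<q' r'<s'
... | refl , refl | refl , refl = refl
orientation-unique p<q p'<q' p<p' r<s r'<s' r<r' (inj₁ (n₁ , n₂)) (inj₂ (m₁ , m₂))
  with ≐-increasing n₁ m₂ p<q r'<s' | ≐-increasing n₂ m₁ p'<q' r<s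
... | refl , refl | refl , refl = ⊥-elim (<-asym p<p' r<r')
orientation-unique p<q p'<q' p<p' r<s r'<s' r<r' (inj₂ (n₁ , n₂)) (inj₁ (m₁ , m₂))
  with ≐-increasing n₁ m₂ p<q r'<s' | ≐-increasing n₂ m₁ p'<q' r<s
... | refl , refl | refl , refl = ⊥-elim (<-asym p<p' r<r')

module TwoPair {s s' : List Name} (m : TwoPairMove s s') where
  open TwoPairMove m

  changed-names : ∀ p q p' q' → T (orderDiffers s s' p q p' q') →
    BlockName a b c d (p , q) × BlockName a b c d (p' , q')
  changed-names p q p' q' h = Product.map block-name block-name (order-change-in-move move p q p' q' h)

  I₃-unchanged : ∀ n → I₃ n s s' ≡ 0
  I₃-unchanged n = count-none _ (universal (λ { (p , q , r) → unchanged p q r }) (triples n))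
    where
    unchanged : ∀ p q r → ¬ T ((p <ᵇ q) ∧ (q <ᵇ r) ∧ triDiffers s s' p q r)
    unchanged p q r h with increasing-sound p q r h
    ... | p<q , q<r , changed with triDiffers-cases s s' p q r changed
    ...   | inj₁ pq-pr with changed-names p q p r pq-pr
    ...     | n₁ , n₂ = <⇒≢ q<r (block-shared apart n₁ n₂)
    unchanged p q r h | p<q , q<r , _ | inj₂ (inj₁ pq-qr) with changed-names p q q r pq-qr
    ...     | n₁ , n₂ = <⇒≢ (<-trans p<q q<r) (block-shared apart (blockName-flip n₁) n₂)
    unchanged p q r h | p<q , q<r , _ | inj₂ (inj₂ pr-qr) with changed-names p r q r pr-qr
    ...     | n₁ , n₂ = <⇒≢ p<q (block-shared apart (blockName-flip n₁) (blockName-flip n₂))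

  I₂₂-atMostOne : ∀ n → I₂₂ n s s' ≤ 1
  I₂₂-atMostOne n = count-atMostOne _ (quads-unique n)
    λ { ((p , q) , (p' , q')) ((r , t) , (r' , t')) h h' → same-quad p q p' q' r t r' t' h h' }
    where
    oriented : ∀ p q p' q' → T (disjointPairs p q p' q' ∧ orderDiffers s s' p q p' q') →
      p < q × p' < q' × p < p' × Orientation a b c d p q p' q'
    oriented p q p' q' h with to T-∧ h
    ... | disjoint , changed with disjointPairs-sound p q p' q' disjoint | changed-names p q p' q' changed
    ...   | p<q , p'<q' , p<p' , _ , _ | n₁ , n₂ = p<q , p'<q' , p<p' , orientation n₁ n₂ p<q p'<q' p<p'
    same-quad : ∀ p q p' q' r t r' t' →
      T (disjointPairs p q p' q' ∧ orderDiffers s s' p q p' q') →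
      T (disjointPairs r t r' t' ∧ orderDiffers s s' r t r' t') →
      ((p , q) , (p' , q')) ≡ ((r , t) , (r' , t'))
    same-quad p q p' q' r t r' t' h h' with oriented p q p' q' h | oriented r t r' t' h'
    ... | p<q , p'<q' , p<p' , o | r<t , r'<t' , r<r' , o' = orientation-unique p<q p'<q' p<p' r<t r'<t' r<r' o o'

path-bounds : ∀ n {u v} (path : Path u v) →
  (I₃ n (S u) (S v) ≤ countI path) × (I₂₂ n (S u) (S v) ≤ countII path)
path-bounds n {u} done = ≤-reflexive (I₃-self n (S u)) , ≤-reflexive (I₂₂-self n (S u))
path-bounds n {u} {v} (step {w = w} (typeI pre post i j adjacent) path)
  with I₃-bound , I₂₂-bound ← path-bounds n path =
    ≤-trans (I₃-triangle n (S u) (S w) (S v)) (+-mono-≤ (ThreeStrand.I₃-atMostOne move n) I₃-bound) ,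
    ≤-trans (I₂₂-triangle n (S u) (S w) (S v))
            (+-mono-≤ (≤-reflexive (ThreeStrand.I₂₂-unchanged move n)) I₂₂-bound)
  where
  move : ThreeStrandMove (S u) (S w)
  move = typeI-move pre post i j adjacent
path-bounds n {u} {v} (step {w = w} (typeII pre post i j distant) path)
  with I₃-bound , I₂₂-bound ← path-bounds n path =
    ≤-trans (I₃-triangle n (S u) (S w) (S v)) (+-mono-≤ (≤-reflexive (TwoPair.I₃-unchanged move n)) I₃-bound) ,
    ≤-trans (I₂₂-triangle n (S u) (S w) (S v)) (+-mono-≤ (TwoPair.I₂₂-atMostOne move n) I₂₂-bound)
  where
  move : TwoPairMove (S u) (S w)
  move = typeII-move pre post i j distant

len-split : ∀ {u v} (path : Path u v) → len path ≡ countI path + countII path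
len-split done = refl
len-split (step (typeI _ _ _ _ _) path)  = cong suc (len-split path)
len-split (step (typeII _ _ _ _ _) path) = trans (cong suc (len-split path)) (sym (+-suc (countI path) (countII path)))

proposition1p11 : (n : ℕ) (u v : Word) → Valid n u → Valid n v → Reduced n u → Reduced n v → Equiv u v → (p : Path u v) → (I₃ n (S u) (S v) ≤ countI p) × (I₂₂ n (S u) (S v) ≤ countII p) × (I₃ n (S u) (S v) + I₂₂ n (S u) (S v) ≤ len p)
proposition1p11 n u v _ _ _ _ _ path with I₃-bound , I₂₂-bound ← path-bounds n path =
  I₃-bound , I₂₂-bound , ≤-trans (+-mono-≤ I₃-bound I₂₂-bound) (≤-reflexive (sym (len-split path)))
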